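{- The integers $11$, $17$ and $29$ are universal numbers; that is, for each $k\in\{11,17,29\}$, every prime $p\leqslant k$ and every $b\in\mathbb{N}$, the set $\{\binom nk \bmod p^b:\ n\in\mathbb{N}\}$ equals all of $\mathbb{Z}/p^b\mathbb{Z}$ (equivalently, $\{\binom nk:\ n\in\mathbb{N}\}$ is dense in the ring $\mathbb{Z}_p$ of $p$-adic integers for every prime $p\leqslant k$).
   Context: For $k\in\mathbb{N}$ and $m\in\mathbb{Z}^+$ let $R_m(k)=\{\binom nk \bmod m:\ n\in\mathbb{N}\}$; $m$ is called $k$-universal if $R_m(k)=\mathbb{Z}/m\mathbb{Z}$. A positive integer $k$ is called universal if every power of every prime $p\leqslant k$ is $k$-universal. Here $\mathbb{N}=\{0,1,2,\ldots\}$. -}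

module Defs where

open import Data.Nat using (ℕ; _+_; _*_; _^_; _≤_; _<_)
open import Data.Nat.Combinatorics using (_C_)
open import Data.Nat.Primality using (Prime)
open import Data.Product using (∃₂)
open import Relation.Binary.PropositionalEquality using (_≡_)

-- R_m(k) = Z/mZ : every residue r with 0 ≤ r < m is attained, i.e.
-- there is n with  n C k ≡ r (mod m), written as n C k = r + q * m.
-- (For m > 0 this says exactly that the reduction map hits every class.)
_IsUniversalFor_ : ℕ → ℕ → Set
m IsUniversalFor k = ∀ r → r < m → ∃₂ λ n q → n C k ≡ r + q * m

Universal : ℕ → Set
Universal k = ∀ p → Prime p → p ≤ k → ∀ b → (p ^ b) IsUniversalFor k

module Submission where

-- Proof by Hensel lifting.  Write k = k′+1, F(x) = C(x, k), and let K be a common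
-- multiple of 1, …, k with K = p^L·K′, p ∤ K′.  Then
--   D(x) = Σ_{i ≤ k′} (−1)^i (K/(i+1)) C(x, k′−i)
-- is K times the formal derivative of F.  Vandermonde's identity together with the
-- absorption identity i·C(h,i) = h·C(h−1,i−1) gives, whenever p^(L+n) ∣ h, the
-- Taylor congruence  K·(F(h+z) − F(z)) ≡ h·D(z)  (mod h·p^n),  and shows that
-- D(z) mod p only depends on z mod p^(L+1).  Consequently a root x of F(x) ≡ r
-- (mod p) with p ∤ D(x) lifts, Newton-style, to a root of F ≡ r modulo every p^b.
-- Universality of k thus reduces to exhibiting, for each prime p ≤ k and each
-- residue r mod p, such a nonsingular root; for k = 11, 17, 29 (with
-- K = lcm(1, …, k)) they are listed in tables that Agda checks by evaluation.

open import Defs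
open import Data.Bool using (if_then_else_)
open import Data.List using (List; []; _∷_; head; drop)
open import Data.Maybe using (fromMaybe)
open import Data.Nat as ℕ using (ℕ; zero; suc; pred; _∸_; _≤_; _<_; _^_; NonZero; z≤n; s≤s)
import Data.Nat.Properties as ℕ
open import Data.Nat.Combinatorics using (_C_; nCk+nC[k+1]≡[n+1]C[k+1]; nC1≡n)
open import Data.Nat.Coprimality using (prime⇒coprime; coprime-Bézout)
open import Data.Nat.DivMod using (m/n*n≡m; m%n<n)
open import Data.Nat.Divisibility as ℕ∣ using (divides-refl)
open import Data.Nat.GCD using (module Bézout)
open import Data.Nat.Induction using (<-rec)
open import Data.Nat.LCM using (lcm; m∣lcm[m,n]; n∣lcm[m,n]; lcm-least)
open import Data.Nat.Primality using (Prime; prime?; prime⇒nonZero; prime⇒nonTrivial; euclidsLemma)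
import Data.Nat.Tactic.RingSolver as ℕ-Solver
open import Data.Integer as ℤ using (ℤ; +_; _+_; _-_; _*_; -_; ∣_∣; _%ℕ_; _/ℕ_)
import Data.Integer.Properties as ℤ
open import Data.Integer.DivMod using (a≡a%ℕn+[a/ℕn]*n; n%ℕd<d)
open import Data.Integer.Divisibility.Signed
  using (_∣_; _∣?_; divides; ∣ᵤ⇒∣; ∣⇒∣ᵤ; ∣m∣n⇒∣m+n; ∣m∣n⇒∣m-n; ∣m⇒∣-m; ∣m⇒∣m*n; ∣n⇒∣m*n;
         *-monoʳ-∣; ∣-trans; ∣-refl; ∣-reflexive)
open import Data.Integer.Tactic.RingSolver using (solve-∀)
open import Data.Product using (∃; ∃₂; _×_; _,_)
open import Data.Sum using (inj₁; inj₂)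
open import Level using (0ℓ)
open import Relation.Binary.Bundles using (Setoid)
open import Relation.Binary.PropositionalEquality
  using (_≡_; refl; sym; trans; cong; cong₂; subst; subst₂; module ≡-Reasoning)
import Relation.Binary.Reasoning.Setoid as SetoidReasoning
open import Relation.Nullary using (¬_; Dec; yes; no; contradiction)
open import Relation.Nullary.Decidable using (map′; ¬?; _×-dec_; _→-dec_; from-yes)

Σ≤ : ℕ → (ℕ → ℤ) → ℤ
Σ≤ zero    f = f 0
Σ≤ (suc n) f = f 0 + Σ≤ n (λ i → f (suc i))

Σ-cong : ∀ n {f g : ℕ → ℤ} → (∀ i → i ≤ n → f i ≡ g i) → Σ≤ n f ≡ Σ≤ n g
Σ-cong zero    f≡g = f≡g 0 z≤n
Σ-cong (suc n) f≡g =
  cong₂ _+_ (f≡g 0 z≤n) (Σ-cong n (λ i i≤n → f≡g (suc i) (s≤s i≤n)))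

Σ-+ : ∀ n (f g : ℕ → ℤ) → Σ≤ n (λ i → f i + g i) ≡ Σ≤ n f + Σ≤ n g
Σ-+ zero    f g = refl
Σ-+ (suc n) f g = trans
  (cong (_+_ (f 0 + g 0)) (Σ-+ n (λ i → f (suc i)) (λ i → g (suc i))))
  (interchange (f 0) (g 0) _ _)
  where
  interchange : ∀ a b c d → a + b + (c + d) ≡ a + c + (b + d)
  interchange = solve-∀

Σ-*ˡ : ∀ n c (f : ℕ → ℤ) → c * Σ≤ n f ≡ Σ≤ n (λ i → c * f i)
Σ-*ˡ zero    c f = refl
Σ-*ˡ (suc n) c f = trans (ℤ.*-distribˡ-+ c (f 0) _)
  (cong (_+_ (c * f 0)) (Σ-*ˡ n c (λ i → f (suc i))))

Σ-vanishing-tail : ∀ n (f : ℕ → ℤ) → (∀ i → f (suc i) ≡ + 0) → Σ≤ n f ≡ f 0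
Σ-vanishing-tail zero    f _  = refl
Σ-vanishing-tail (suc n) f f0 = begin
  f 0 + Σ≤ n (λ i → f (suc i)) ≡⟨ cong (_+_ (f 0)) (Σ-vanishing-tail n _ (λ i → f0 (suc i))) ⟩
  f 0 + f 1                    ≡⟨ cong (_+_ (f 0)) (f0 0) ⟩
  f 0 + + 0                    ≡⟨ ℤ.+-identityʳ (f 0) ⟩
  f 0                          ∎
  where open ≡-Reasoning

Σ-∣ : ∀ n {m} (f : ℕ → ℤ) → (∀ i → i ≤ n → m ∣ f i) → m ∣ Σ≤ n f
Σ-∣ zero    f m∣f = m∣f 0 z≤n
Σ-∣ (suc n) f m∣f =
  ∣m∣n⇒∣m+n (m∣f 0 z≤n) (Σ-∣ n (λ i → f (suc i)) (λ i i≤n → m∣f (suc i) (s≤s i≤n)))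

-- Congruence of integers modulo m: m divides the difference.
-- (A record, so that a, b and m can be inferred from a proof.)
infix 4 _≡_[mod_]
record _≡_[mod_] (a b m : ℤ) : Set where
  constructor congruent
  field divides-difference : m ∣ a - b
open _≡_[mod_] public

*-distribˡ-- : ∀ c a b → c * (a - b) ≡ c * a - c * b
*-distribˡ-- = solve-∀

module _ {m : ℤ} where

  ≡⇒≡-mod : ∀ {a b} → a ≡ b → a ≡ b [mod m ]
  ≡⇒≡-mod {a} refl = congruent (divides (+ 0) (trans (ℤ.+-inverseʳ a) (sym (ℤ.*-zeroˡ m))))

  mod-sym : ∀ {a b} → a ≡ b [mod m ] → b ≡ a [mod m ]
  mod-sym {a} {b} (congruent m∣a-b) = congruent (subst (m ∣_) (negate-difference a b) (∣m⇒∣-m m∣a-b))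
    where
    negate-difference : ∀ a b → - (a - b) ≡ b - a
    negate-difference = solve-∀

  mod-trans : ∀ {a b c} → a ≡ b [mod m ] → b ≡ c [mod m ] → a ≡ c [mod m ]
  mod-trans {a} {b} {c} (congruent m∣a-b) (congruent m∣b-c) =
    congruent (subst (m ∣_) (telescope a b c) (∣m∣n⇒∣m+n m∣a-b m∣b-c))
    where
    telescope : ∀ a b c → a - b + (b - c) ≡ a - c
    telescope = solve-∀

  mod-+ : ∀ {a b c d} → a ≡ b [mod m ] → c ≡ d [mod m ] → a + c ≡ b + d [mod m ]
  mod-+ {a} {b} {c} {d} (congruent m∣a-b) (congruent m∣c-d) =
    congruent (subst (m ∣_) (regroup a b c d) (∣m∣n⇒∣m+n m∣a-b m∣c-d))
    where
    regroup : ∀ a b c d → a - b + (c - d) ≡ a + c - (b + d)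
    regroup = solve-∀

  mod-- : ∀ {a b c d} → a ≡ b [mod m ] → c ≡ d [mod m ] → a - c ≡ b - d [mod m ]
  mod-- {a} {b} {c} {d} (congruent m∣a-b) (congruent m∣c-d) =
    congruent (subst (m ∣_) (regroup a b c d) (∣m∣n⇒∣m-n m∣a-b m∣c-d))
    where
    regroup : ∀ a b c d → a - b - (c - d) ≡ a - c - (b - d)
    regroup = solve-∀

  mod-scale : ∀ c {a b} → a ≡ b [mod m ] → c * a ≡ c * b [mod c * m ]
  mod-scale c {a} {b} (congruent m∣a-b) = congruent (subst (c * m ∣_) (*-distribˡ-- c a b) (*-monoʳ-∣ c m∣a-b))

  mod-*ˡ : ∀ c {a b} → a ≡ b [mod m ] → c * a ≡ c * b [mod m ]
  mod-*ˡ c {a} {b} (congruent m∣a-b) = congruent (subst (m ∣_) (*-distribˡ-- c a b) (∣n⇒∣m*n c m∣a-b))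

  mod-* : ∀ {a b c d} → a ≡ b [mod m ] → c ≡ d [mod m ] → a * c ≡ b * d [mod m ]
  mod-* {a} {b} {c} {d} a≡b c≡d = mod-trans
    (subst₂ (λ x y → x ≡ y [mod m ]) (ℤ.*-comm c a) (ℤ.*-comm c b) (mod-*ˡ c a≡b))
    (mod-*ˡ b c≡d)

  ∣⇒≡0-mod : ∀ {a} → m ∣ a → a ≡ + 0 [mod m ]
  ∣⇒≡0-mod {a} m∣a = congruent (subst (m ∣_) (sym (ℤ.+-identityʳ a)) m∣a)

  ≡0-mod⇒∣ : ∀ {a} → a ≡ + 0 [mod m ] → m ∣ a
  ≡0-mod⇒∣ {a} (congruent m∣a-0) = subst (m ∣_) (ℤ.+-identityʳ a) m∣a-0

  mod-setoid : Setoid 0ℓ 0ℓ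
  mod-setoid = record
    { Carrier = ℤ
    ; _≈_ = λ a b → a ≡ b [mod m ]
    ; isEquivalence = record { refl = ≡⇒≡-mod refl ; sym = mod-sym ; trans = mod-trans }
    }

mod-weaken : ∀ {m n a b} → n ∣ m → a ≡ b [mod m ] → a ≡ b [mod n ]
mod-weaken n∣m (congruent m∣a-b) = congruent (∣-trans n∣m m∣a-b)

Σ-mod-cong : ∀ n {m} {f g : ℕ → ℤ} → (∀ i → i ≤ n → f i ≡ g i [mod m ]) →
             Σ≤ n f ≡ Σ≤ n g [mod m ]
Σ-mod-cong zero    f≡g = f≡g 0 z≤n
Σ-mod-cong (suc n) f≡g = mod-+ (f≡g 0 z≤n) (Σ-mod-cong n (λ i i≤n → f≡g (suc i) (s≤s i≤n)))

absorption-suc : ∀ n k → suc k ℕ.* (suc n C suc k) ≡ suc n ℕ.* (n C k)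
absorption-suc n       zero    =
  trans (ℕ.*-identityˡ (suc n C 1)) (trans (nC1≡n (suc n)) (sym (ℕ.*-identityʳ (suc n))))
absorption-suc zero    (suc k) = ℕ.*-zeroʳ (suc (suc k))
absorption-suc (suc n) (suc k) = begin
  suc (suc k) ℕ.* (suc (suc n) C suc (suc k))
    ≡⟨ cong (suc (suc k) ℕ.*_) (sym (nCk+nC[k+1]≡[n+1]C[k+1] (suc n) (suc k))) ⟩
  suc (suc k) ℕ.* (a ℕ.+ b)
    ≡⟨ regroup k a b ⟩
  suc k ℕ.* a ℕ.+ suc (suc k) ℕ.* b ℕ.+ a
    ≡⟨ cong₂ (λ x y → x ℕ.+ y ℕ.+ a) (absorption-suc n k) (absorption-suc n (suc k)) ⟩
  suc n ℕ.* (n C k) ℕ.+ suc n ℕ.* (n C suc k) ℕ.+ a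
    ≡⟨ cong (ℕ._+ a) (sym (ℕ.*-distribˡ-+ (suc n) (n C k) (n C suc k))) ⟩
  suc n ℕ.* (n C k ℕ.+ n C suc k) ℕ.+ a
    ≡⟨ cong (λ x → suc n ℕ.* x ℕ.+ a) (nCk+nC[k+1]≡[n+1]C[k+1] n k) ⟩
  suc n ℕ.* a ℕ.+ a
    ≡⟨ ℕ.+-comm (suc n ℕ.* a) a ⟩
  suc (suc n) ℕ.* a ∎
  where
  open ≡-Reasoning
  a = suc n C suc k
  b = suc n C suc (suc k)
  regroup : ∀ k a b → suc (suc k) ℕ.* (a ℕ.+ b) ≡ suc k ℕ.* a ℕ.+ suc (suc k) ℕ.* b ℕ.+ a
  regroup = ℕ-Solver.solve-∀

absorption : ∀ n k → suc k ℕ.* (n C suc k) ≡ n ℕ.* (pred n C k)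
absorption zero    k = ℕ.*-zeroʳ (suc k)
absorption (suc n) k = absorption-suc n k

binom : ℕ → ℕ → ℤ
binom n k = + (n C k)

pascal : ∀ n k → binom (suc n) (suc k) ≡ binom n k + binom n (suc k)
pascal n k = trans (cong +_ (sym (nCk+nC[k+1]≡[n+1]C[k+1] n k))) (ℤ.pos-+ (n C k) (n C suc k))

vandermonde : ∀ a b j → binom (a ℕ.+ b) j ≡ Σ≤ j (λ i → binom a i * binom b (j ∸ i))
vandermonde zero    b j       = sym (trans
  (Σ-vanishing-tail j (λ i → binom 0 i * binom b (j ∸ i)) (λ _ → refl))
  (ℤ.*-identityˡ (binom b j)))
vandermonde (suc a) b zero    = refl
vandermonde (suc a) b (suc j) = begin
  binom (suc (a ℕ.+ b)) (suc j)
    ≡⟨ pascal (a ℕ.+ b) j ⟩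
  binom (a ℕ.+ b) j + binom (a ℕ.+ b) (suc j)
    ≡⟨ cong₂ _+_ (vandermonde a b j) (vandermonde a b (suc j)) ⟩
  S₀ + (+ 1 * binom b (suc j) + S₁)
    ≡⟨ regroup S₀ (binom b (suc j)) S₁ ⟩
  + 1 * binom b (suc j) + (S₀ + S₁)
    ≡⟨ cong (_+_ (+ 1 * binom b (suc j))) (sym (Σ-+ j _ _)) ⟩
  + 1 * binom b (suc j) + Σ≤ j (λ i → binom a i * binom b (j ∸ i) + binom a (suc i) * binom b (j ∸ i))
    ≡⟨ cong (_+_ (+ 1 * binom b (suc j)))
         (Σ-cong j (λ i _ → sym (ℤ.*-distribʳ-+ (binom b (j ∸ i)) (binom a i) (binom a (suc i))))) ⟩
  + 1 * binom b (suc j) + Σ≤ j (λ i → (binom a i + binom a (suc i)) * binom b (j ∸ i))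
    ≡⟨ cong (_+_ (+ 1 * binom b (suc j))) (Σ-cong j (λ i _ → cong (_* binom b (j ∸ i)) (sym (pascal a i)))) ⟩
  Σ≤ (suc j) (λ i → binom (suc a) i * binom b (suc j ∸ i)) ∎
  where
  open ≡-Reasoning
  S₀ = Σ≤ j (λ i → binom a i * binom b (j ∸ i))
  S₁ = Σ≤ j (λ i → binom a (suc i) * binom b (j ∸ i))
  regroup : ∀ x y z → x + (+ 1 * y + z) ≡ + 1 * y + (x + z)
  regroup = solve-∀

binom-increment : ∀ h z j →
  binom (h ℕ.+ z) (suc j) - binom z (suc j) ≡ Σ≤ j (λ i → binom h (suc i) * binom z (j ∸ i))
binom-increment h z j = begin
  binom (h ℕ.+ z) (suc j) - binom z (suc j)
    ≡⟨ cong (_- binom z (suc j)) (vandermonde h z (suc j)) ⟩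
  + 1 * binom z (suc j) + Δ - binom z (suc j)
    ≡⟨ cancel (binom z (suc j)) Δ ⟩
  Δ ∎
  where
  open ≡-Reasoning
  Δ = Σ≤ j (λ i → binom h (suc i) * binom z (j ∸ i))
  cancel : ∀ x y → + 1 * x + y - x ≡ y
  cancel = solve-∀

residue-≡ : ∀ a d .{{_ : NonZero d}} → a ≡ + (a %ℕ d) [mod + d ]
residue-≡ a d = congruent (divides (a /ℕ d) (begin
  a - + (a %ℕ d)                           ≡⟨ cong (_- + (a %ℕ d)) (a≡a%ℕn+[a/ℕn]*n a d) ⟩
  + (a %ℕ d) + (a /ℕ d) * + d - + (a %ℕ d) ≡⟨ cancel (+ (a %ℕ d)) ((a /ℕ d) * + d) ⟩
  (a /ℕ d) * + d                           ∎))
  where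
  open ≡-Reasoning
  cancel : ∀ x y → x + y - x ≡ y
  cancel = solve-∀

representative : ∀ {a r M} .{{_ : NonZero M}} → + a ≡ + r [mod + M ] → r < M →
                 ∃ λ q → a ≡ r ℕ.+ q ℕ.* M
representative {a} {r} {M} a≡r r<M with ℕ.≤-<-connex r a
... | inj₁ r≤a = q , trans (sym (ℕ.m+[n∸m]≡n r≤a)) (cong (r ℕ.+_) a∸r≡qM)
  where
  M∣a∸r : M ℕ∣.∣ a ∸ r
  M∣a∸r = subst (λ x → M ℕ∣.∣ ∣ x ∣) (trans (ℤ.m-n≡m⊖n a r) (ℤ.⊖-≥ r≤a))
                (∣⇒∣ᵤ (divides-difference a≡r))
  q = ℕ∣.quotient M∣a∸r
  a∸r≡qM = ℕ∣.m∣n⇒n≡quotient*m M∣a∸r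
... | inj₂ a<r = contradiction M≤r∸a (ℕ.<⇒≱ (ℕ.≤-<-trans (ℕ.m∸n≤m r a) r<M))
  where
  instance
    r∸a≢0 : NonZero (r ∸ a)
    r∸a≢0 = ℕ.≢-nonZero (ℕ.m>n⇒m∸n≢0 a<r)
  M≤r∸a : M ≤ r ∸ a
  M≤r∸a = ℕ∣.∣⇒≤ (subst (M ℕ∣.∣_) (trans (cong ∣_∣ (ℤ.m-n≡m⊖n a r)) (ℤ.∣⊖∣-< a<r))
                         (∣⇒∣ᵤ (divides-difference a≡r)))

^-mono-∣ : ∀ p {m n} → m ≤ n → p ^ m ℕ∣.∣ p ^ n
^-mono-∣ p {m} {n} m≤n = ℕ∣.divides (p ^ (n ∸ m)) (begin
  p ^ n                ≡⟨ cong (p ^_) (sym (ℕ.m+[n∸m]≡n m≤n)) ⟩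
  p ^ (m ℕ.+ (n ∸ m))  ≡⟨ ℕ.^-distribˡ-+-* p m (n ∸ m) ⟩
  p ^ m ℕ.* p ^ (n ∸ m) ≡⟨ ℕ.*-comm (p ^ m) (p ^ (n ∸ m)) ⟩
  p ^ (n ∸ m) ℕ.* p ^ m ∎)
  where open ≡-Reasoning

module _ {p : ℕ} (p-prime : Prime p) where

  private instance
    p≢0 : NonZero p
    p≢0 = prime⇒nonZero p-prime

  prime-power-cancel : ∀ {u} → ¬ p ℕ∣.∣ u → ∀ n {A} → p ^ n ℕ∣.∣ u ℕ.* A → p ^ n ℕ∣.∣ A
  prime-power-cancel p∤u zero    {A} _ = ℕ∣.1∣ A
  prime-power-cancel {u} p∤u (suc n) {A} pⁿ⁺¹∣uA
    with euclidsLemma u A p-prime (ℕ∣.∣-trans (ℕ∣.m∣m*n (p ^ n)) pⁿ⁺¹∣uA)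
  ... | inj₁ p∣u                = contradiction p∣u p∤u
  ... | inj₂ (divides-refl A′) = subst (ℕ∣._∣ A′ ℕ.* p) (ℕ.*-comm (p ^ n) p) (ℕ∣.*-monoˡ-∣ p pⁿ∣A′)
    where
    regroup : ∀ u a p → u ℕ.* (a ℕ.* p) ≡ p ℕ.* (u ℕ.* a)
    regroup = ℕ-Solver.solve-∀
    pⁿ∣uA′ : p ^ n ℕ∣.∣ u ℕ.* A′
    pⁿ∣uA′ = ℕ∣.*-cancelˡ-∣ p (subst (p ℕ.* p ^ n ℕ∣.∣_) (regroup u A′ p) pⁿ⁺¹∣uA)
    pⁿ∣A′ : p ^ n ℕ∣.∣ A′
    pⁿ∣A′ = prime-power-cancel p∤u n pⁿ∣uA′

  p-part : ∀ K → .{{NonZero K}} → ∃₂ λ L K′ → K ≡ p ^ L ℕ.* K′ × ¬ p ℕ∣.∣ K′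
  p-part = <-rec Splits split
    where
    instance
      p-nonTrivial : ℕ.NonTrivial p
      p-nonTrivial = prime⇒nonTrivial p-prime
    Splits : ℕ → Set
    Splits K = .{{NonZero K}} → ∃₂ λ L K′ → K ≡ p ^ L ℕ.* K′ × ¬ p ℕ∣.∣ K′
    split : ∀ K → (∀ {K₁} → K₁ < K → Splits K₁) → Splits K
    split K smaller with p ℕ∣.∣? K
    ... | no  p∤K = 0 , K , sym (ℕ.*-identityˡ K) , p∤K
    ... | yes p∣K with smaller (ℕ∣.quotient-< p∣K) {{ℕ∣.quotient≢0 p∣K}}
    ...   | L , K′ , K₁≡ , p∤K′ = suc L , K′ , K≡ , p∤K′
      where
      K≡ : K ≡ p ^ suc L ℕ.* K′
      K≡ = trans (ℕ∣.m∣n⇒n≡quotient*m p∣K)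
             (trans (cong (ℕ._* p) K₁≡) (regroup (p ^ L) K′ p))
        where
        regroup : ∀ a b p → a ℕ.* b ℕ.* p ≡ p ℕ.* a ℕ.* b
        regroup = ℕ-Solver.solve-∀

  inverse-mod : ∀ {a} → ¬ (+ p ∣ a) → ∃ λ b → b * a ≡ + 1 [mod + p ]
  inverse-mod {a} p∤a = from-Bézout (coprime-Bézout (prime⇒coprime p-prime {{ρ≢0}} (n%ℕd<d a p)))
    where
    open ≡-Reasoning
    ρ = a %ℕ p
    a≡ρ : a ≡ + ρ [mod + p ]
    a≡ρ = residue-≡ a p
    ρ≢0 : NonZero ρ
    ρ≢0 = ℕ.≢-nonZero λ ρ≡0 → p∤a (subst (+ p ∣_) (ℤ.+-identityʳ a)
            (divides-difference (subst (λ r → a ≡ + r [mod + p ]) ρ≡0 a≡ρ)))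
    negate : ∀ y ρ → - y * ρ - + 1 ≡ - (+ 1 + y * ρ)
    negate = solve-∀
    cancel : ∀ z → + 1 + z - + 1 ≡ z
    cancel = solve-∀
    ℕ→ℤ : ∀ u v w z → 1 ℕ.+ u ℕ.* v ≡ w ℕ.* z → + 1 + + u * + v ≡ + w * + z
    ℕ→ℤ u v w z eq = begin
      + 1 + + u * + v     ≡⟨ cong (_+_ (+ 1)) (sym (ℤ.pos-* u v)) ⟩
      + (1 ℕ.+ u ℕ.* v)   ≡⟨ cong +_ eq ⟩
      + (w ℕ.* z)         ≡⟨ ℤ.pos-* w z ⟩
      + w * + z           ∎
    from-Bézout : Bézout.Identity 1 p ρ → ∃ λ b → b * a ≡ + 1 [mod + p ]
    from-Bézout (Bézout.+- x y 1+yρ≡xp) = - + y , mod-trans (mod-*ˡ (- + y) a≡ρ) (congruent (divides (- + x) (begin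
      - + y * + ρ - + 1     ≡⟨ negate (+ y) (+ ρ) ⟩
      - (+ 1 + + y * + ρ)   ≡⟨ cong -_ (ℕ→ℤ y ρ x p 1+yρ≡xp) ⟩
      - (+ x * + p)         ≡⟨ ℤ.neg-distribˡ-* (+ x) (+ p) ⟩
      - + x * + p           ∎)))
    from-Bézout (Bézout.-+ x y 1+xp≡yρ) = + y , mod-trans (mod-*ˡ (+ y) a≡ρ) (congruent (divides (+ x) (begin
      + y * + ρ - + 1       ≡⟨ cong (_- + 1) (sym (ℕ→ℤ x p y ρ 1+xp≡yρ)) ⟩
      + 1 + + x * + p - + 1 ≡⟨ cancel (+ x * + p) ⟩
      + x * + p             ∎)))

sign : ℕ → ℤ
sign zero    = + 1
sign (suc i) = - sign i

-- K times the formal derivative of x ↦ C(x, k′+1), evaluated at z: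
--   Σ_{i ≤ k′} (−1)^i (K/(i+1)) C(z, k′−i).
-- (The divisions are exact once 1, …, k′+1 all divide K.)
scaled-derivative : ℕ → ℕ → ℕ → ℤ
scaled-derivative k′ K z = Σ≤ k′ (λ i → sign i * + (K ℕ./ suc i) * binom z (k′ ∸ i))

module Hensel (k′ p K L K′ : ℕ) (p-prime : Prime p)
              (K-multiple : ∀ i → i ≤ k′ → suc i ℕ∣.∣ K)
              (K≡ : K ≡ p ^ L ℕ.* K′) (p∤K′ : ¬ p ℕ∣.∣ K′) where

  private instance
    p≢0 : NonZero p
    p≢0 = prime⇒nonZero p-prime
    pᴸ≢0 : NonZero (p ^ L)
    pᴸ≢0 = ℕ.m^n≢0 p L

  F : ℕ → ℤ
  F z = binom z (suc k′)

  D : ℕ → ℤ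
  D = scaled-derivative k′ K

  pw : ℕ → ℤ
  pw n = + (p ^ n)

  pw-+ : ∀ m n → pw (m ℕ.+ n) ≡ pw m * pw n
  pw-+ m n = trans (cong +_ (ℕ.^-distribˡ-+-* p m n)) (ℤ.pos-* (p ^ m) (p ^ n))

  K-cancel : ∀ n {X} → p ^ (L ℕ.+ n) ℕ∣.∣ K ℕ.* X → p ^ n ℕ∣.∣ X
  K-cancel n {X} pᴸ⁺ⁿ∣KX = prime-power-cancel p-prime p∤K′ n (ℕ∣.*-cancelˡ-∣ (p ^ L)
    (subst₂ ℕ∣._∣_ (ℕ.^-distribˡ-+-* p L n) (trans (cong (ℕ._* X) K≡) (ℕ.*-assoc (p ^ L) K′ X))
      pᴸ⁺ⁿ∣KX))

  K-cancelℤ : ∀ n {X} → pw (L ℕ.+ n) ∣ + K * X → pw n ∣ X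
  K-cancelℤ n {X} pᴸ⁺ⁿ∣KX =
    ∣ᵤ⇒∣ (K-cancel n (subst (p ^ (L ℕ.+ n) ℕ∣.∣_) (ℤ.abs-* (+ K) X) (∣⇒∣ᵤ pᴸ⁺ⁿ∣KX)))

  scaled-absorption : ∀ h i → i ≤ k′ → K ℕ.* (h C suc i) ≡ K ℕ./ suc i ℕ.* (h ℕ.* (pred h C i))
  scaled-absorption h i i≤k′ = begin
    K ℕ.* (h C suc i)                          ≡⟨ cong (ℕ._* (h C suc i)) (sym (m/n*n≡m (K-multiple i i≤k′))) ⟩
    K ℕ./ suc i ℕ.* suc i ℕ.* (h C suc i)      ≡⟨ ℕ.*-assoc (K ℕ./ suc i) (suc i) (h C suc i) ⟩
    K ℕ./ suc i ℕ.* (suc i ℕ.* (h C suc i))    ≡⟨ cong (K ℕ./ suc i ℕ.*_) (absorption h i) ⟩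
    K ℕ./ suc i ℕ.* (h ℕ.* (pred h C i))       ∎
    where open ≡-Reasoning

  scaled-absorptionℤ : ∀ h′ i → i ≤ k′ →
    + K * binom (suc h′) (suc i) ≡ + (K ℕ./ suc i) * (+ suc h′ * binom h′ i)
  scaled-absorptionℤ h′ i i≤k′ = begin
    + K * binom h (suc i)                    ≡⟨ ℤ.pos-* K (h C suc i) ⟨
    + (K ℕ.* (h C suc i))                    ≡⟨ cong +_ (scaled-absorption h i i≤k′) ⟩
    + (K ℕ./ suc i ℕ.* (h ℕ.* (h′ C i)))     ≡⟨ ℤ.pos-* (K ℕ./ suc i) (h ℕ.* (h′ C i)) ⟩
    + (K ℕ./ suc i) * + (h ℕ.* (h′ C i))     ≡⟨ cong (+ (K ℕ./ suc i) *_) (ℤ.pos-* h (h′ C i)) ⟩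
    + (K ℕ./ suc i) * (+ h * binom h′ i)     ∎
    where
    open ≡-Reasoning
    h = suc h′

  small-binom-divisible : ∀ n {h} i → i ≤ k′ → p ^ (L ℕ.+ n) ℕ∣.∣ h → pw n ∣ binom h (suc i)
  small-binom-divisible n {h} i i≤k′ pᴸ⁺ⁿ∣h = ∣ᵤ⇒∣ (K-cancel n
    (subst (p ^ (L ℕ.+ n) ℕ∣.∣_) (sym (scaled-absorption h i i≤k′))
      (ℕ∣.∣n⇒∣m*n (K ℕ./ suc i) (ℕ∣.∣m⇒∣m*n (pred h C i) pᴸ⁺ⁿ∣h))))

  binom-alternating : ∀ n {h} j → j ≤ k′ → p ^ (L ℕ.+ n) ℕ∣.∣ suc h → binom h j ≡ sign j [mod pw n ]
  binom-alternating n     zero    _    _       = ≡⇒≡-mod refl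
  binom-alternating n {h} (suc j) j<k′ pᴸ⁺ⁿ∣h+1 = begin
    binom h (suc j)                   ≡⟨ pascal-solved ⟩
    binom (suc h) (suc j) - binom h j ≈⟨ mod-- (∣⇒≡0-mod (small-binom-divisible n j (ℕ.<⇒≤ j<k′) pᴸ⁺ⁿ∣h+1))
                                               (binom-alternating n j (ℕ.<⇒≤ j<k′) pᴸ⁺ⁿ∣h+1) ⟩
    + 0 - sign j                      ≡⟨ ℤ.+-identityˡ (- sign j) ⟩
    sign (suc j)                      ∎
    where
    open SetoidReasoning mod-setoid
    pascal-solved : binom h (suc j) ≡ binom (suc h) (suc j) - binom h j
    pascal-solved = trans (sym (cancel (binom h j) (binom h (suc j))))
                          (cong (_- binom h j) (sym (pascal h j)))
      where
      cancel : ∀ x y → x + y - x ≡ y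
      cancel = solve-∀

  taylor : ∀ n h z → p ^ (L ℕ.+ n) ℕ∣.∣ h →
           + K * (F (h ℕ.+ z) - F z) ≡ + h * D z [mod + h * pw n ]
  taylor n zero    z _ = ≡⇒≡-mod (vanish (+ K) (F z) (D z))
    where
    vanish : ∀ k x d → k * (x - x) ≡ + 0 * d
    vanish = solve-∀
  taylor n (suc h′) z pᴸ⁺ⁿ∣h = begin
    + K * (F (h ℕ.+ z) - F z)
      ≡⟨ cong (+ K *_) (binom-increment h z k′) ⟩
    + K * Σ≤ k′ (λ i → binom h (suc i) * binom z (k′ ∸ i))
      ≡⟨ Σ-*ˡ k′ (+ K) _ ⟩
    Σ≤ k′ (λ i → + K * (binom h (suc i) * binom z (k′ ∸ i)))
      ≈⟨ Σ-mod-cong k′ term ⟩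
    Σ≤ k′ (λ i → + h * (sign i * + (K ℕ./ suc i) * binom z (k′ ∸ i)))
      ≡⟨ Σ-*ˡ k′ (+ h) _ ⟨
    + h * D z ∎
    where
    open SetoidReasoning mod-setoid
    h = suc h′
    -- The i-th terms agree: K·C(h,i+1) = (K/(i+1))·h·C(h−1,i) and C(h−1,i) ≡ (−1)^i.
    term : ∀ i → i ≤ k′ → + K * (binom h (suc i) * binom z (k′ ∸ i))
                          ≡ + h * (sign i * + (K ℕ./ suc i) * binom z (k′ ∸ i)) [mod + h * pw n ]
    term i i≤k′ = begin
      + K * (binom h (suc i) * B)      ≡⟨ factor ⟩
      c * B * (+ h * binom h′ i)       ≈⟨ mod-*ˡ (c * B) (mod-scale (+ h) (binom-alternating n i i≤k′ pᴸ⁺ⁿ∣h)) ⟩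
      c * B * (+ h * sign i)           ≡⟨ regroup c B (+ h) (sign i) ⟩
      + h * (sign i * c * B)           ∎
      where
      B = binom z (k′ ∸ i)
      c = + (K ℕ./ suc i)
      regroup : ∀ c b h s → c * b * (h * s) ≡ h * (s * c * b)
      regroup = solve-∀
      factor : + K * (binom h (suc i) * B) ≡ c * B * (+ h * binom h′ i)
      factor = trans (sym (ℤ.*-assoc (+ K) (binom h (suc i)) B))
                     (trans (cong (_* B) (scaled-absorptionℤ h′ i i≤k′)) (swap c (+ h * binom h′ i) B))
        where
        swap : ∀ x y z → x * y * z ≡ x * z * y
        swap = solve-∀

  binom-periodic : ∀ n {y} z j → j ≤ suc k′ → p ^ (L ℕ.+ n) ℕ∣.∣ y →
                   binom (y ℕ.+ z) j ≡ binom z j [mod pw n ]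
  binom-periodic n     z zero    _      _      = ≡⇒≡-mod refl
  binom-periodic n {y} z (suc j) j<k′+1 pᴸ⁺ⁿ∣y = congruent
    (subst (pw n ∣_) (sym (binom-increment y z j)) (Σ-∣ j _ λ i i≤j →
      ∣m⇒∣m*n (binom z (j ∸ i)) (small-binom-divisible n i (ℕ.≤-trans i≤j (ℕ.s≤s⁻¹ j<k′+1)) pᴸ⁺ⁿ∣y)))

  D-periodic : ∀ {y} z → p ^ (L ℕ.+ 1) ℕ∣.∣ y → D (y ℕ.+ z) ≡ D z [mod + p ]
  D-periodic z pᴸ⁺¹∣y = mod-weaken (∣-reflexive (cong +_ (sym (ℕ.*-identityʳ p))))
    (Σ-mod-cong k′ λ i _ → mod-*ˡ (sign i * + (K ℕ./ suc i))
      (binom-periodic 1 z (k′ ∸ i) (ℕ.≤-trans (ℕ.m∸n≤m k′ i) (ℕ.n≤1+n k′)) pᴸ⁺¹∣y))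

  hensel-step : ∀ {x a r} → a * D x ≡ + 1 [mod + p ] →
                ∀ s {y} → p ^ (L ℕ.+ 1) ℕ∣.∣ y → F (y ℕ.+ x) ≡ r [mod pw (suc s) ] →
                ∃ λ y′ → p ^ (L ℕ.+ 1) ℕ∣.∣ y′ × F (y′ ℕ.+ x) ≡ r [mod pw (suc (suc s)) ]
  hensel-step {x} {a} {r} aD≡1 s {y} pᴸ⁺¹∣y (congruent (divides q Fz-r≡qpᵗ)) =
    h ℕ.+ y , ℕ∣.∣m∣n⇒∣m+n pᴸ⁺¹∣h pᴸ⁺¹∣y , lifted
    where
    t = suc s
    z = y ℕ.+ x
    -- the correction h = p^(L+t)·d, with d ≡ −K′·q·a (mod p)
    e = - (+ K′ * q * a)
    d = e %ℕ p
    h = p ^ (L ℕ.+ t) ℕ.* d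
    M = pw (L ℕ.+ suc t)

    pᴸ⁺¹∣h : p ^ (L ℕ.+ 1) ℕ∣.∣ h
    pᴸ⁺¹∣h = ℕ∣.∣-trans (^-mono-∣ p (ℕ.+-monoʳ-≤ L (s≤s z≤n))) (ℕ∣.m∣m*n d)

    h-cast : + h ≡ pw (L ℕ.+ t) * + d
    h-cast = ℤ.pos-* (p ^ (L ℕ.+ t)) d
    K-cast : + K ≡ pw L * + K′
    K-cast = trans (cong +_ K≡) (ℤ.pos-* (p ^ L) K′)
    M-cast : M ≡ pw (L ℕ.+ t) * + p
    M-cast = trans (cong pw (ℕ.+-suc L t)) (trans (ℤ.pos-* p (p ^ (L ℕ.+ t))) (ℤ.*-comm (+ p) _))

    -- The Taylor error term h·p^t is divisible by M = p^(L+t+1), because t ≥ 1.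
    M∣hpᵗ : M ∣ + h * pw t
    M∣hpᵗ = subst₂ _∣_ (sym M-cast) (sym hpᵗ≡) (*-monoʳ-∣ (pw (L ℕ.+ t)) p∣dpᵗ)
      where
      hpᵗ≡ : + h * pw t ≡ pw (L ℕ.+ t) * (+ d * pw t)
      hpᵗ≡ = trans (cong (_* pw t) h-cast) (ℤ.*-assoc (pw (L ℕ.+ t)) (+ d) (pw t))
      p∣dpᵗ : + p ∣ + d * pw t
      p∣dpᵗ = ∣n⇒∣m*n (+ d) (subst (+ p ∣_) (sym (ℤ.pos-* p (p ^ s))) (∣m⇒∣m*n (pw s) ∣-refl))

    unit-part : + d * D z + + K′ * q ≡ + 0 [mod + p ]
    unit-part = begin
      + d * D z + + K′ * q        ≈⟨ mod-+ (mod-* (mod-sym (residue-≡ e p)) (D-periodic x pᴸ⁺¹∣y)) (≡⇒≡-mod refl) ⟩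
      e * D x + + K′ * q          ≡⟨ factor (+ K′) q a (D x) ⟩
      + K′ * q * (+ 1 - a * D x)  ≈⟨ mod-*ˡ (+ K′ * q) (mod-- (≡⇒≡-mod {a = + 1} refl) aD≡1) ⟩
      + K′ * q * (+ 1 - + 1)      ≡⟨ ℤ.*-zeroʳ (+ K′ * q) ⟩
      + 0                         ∎
      where
      open SetoidReasoning mod-setoid
      factor : ∀ k q a D → - (k * q * a) * D + k * q ≡ k * q * (+ 1 - a * D)
      factor = solve-∀

    expand : + h * D z + + K * (F z - r) ≡ pw (L ℕ.+ t) * (+ d * D z + + K′ * q)
    expand = begin
      + h * D z + + K * (F z - r)
        ≡⟨ cong₂ (λ u v → u * D z + v * (F z - r)) h-cast K-cast ⟩
      pw (L ℕ.+ t) * + d * D z + pw L * + K′ * (F z - r)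
        ≡⟨ cong₂ (λ u v → u * + d * D z + pw L * + K′ * v) (pw-+ L t) Fz-r≡qpᵗ ⟩
      pw L * pw t * + d * D z + pw L * + K′ * (q * pw t)
        ≡⟨ regroup (pw L) (pw t) (+ d) (D z) (+ K′) q ⟩
      pw L * pw t * (+ d * D z + + K′ * q)
        ≡⟨ cong (_* (+ d * D z + + K′ * q)) (pw-+ L t) ⟨
      pw (L ℕ.+ t) * (+ d * D z + + K′ * q) ∎
      where
      open ≡-Reasoning
      regroup : ∀ P T d D k q → P * T * d * D + P * k * (q * T) ≡ P * T * (d * D + k * q)
      regroup = solve-∀

    KΔ≡0 : + K * (F (h ℕ.+ z) - r) ≡ + 0 [mod M ]
    KΔ≡0 = begin
      + K * (F (h ℕ.+ z) - r)
        ≡⟨ split (+ K) (F (h ℕ.+ z)) (F z) r ⟩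
      + K * (F (h ℕ.+ z) - F z) + + K * (F z - r)
        ≈⟨ mod-+ (mod-weaken M∣hpᵗ (taylor t h z (ℕ∣.m∣m*n d))) (≡⇒≡-mod refl) ⟩
      + h * D z + + K * (F z - r)
        ≡⟨ expand ⟩
      pw (L ℕ.+ t) * (+ d * D z + + K′ * q)
        ≈⟨ subst (λ m → pw (L ℕ.+ t) * (+ d * D z + + K′ * q) ≡ pw (L ℕ.+ t) * + 0 [mod m ]) (sym M-cast)
             (mod-scale (pw (L ℕ.+ t)) unit-part) ⟩
      pw (L ℕ.+ t) * + 0
        ≡⟨ ℤ.*-zeroʳ (pw (L ℕ.+ t)) ⟩
      + 0 ∎
      where
      open SetoidReasoning mod-setoid
      split : ∀ k a b r → k * (a - r) ≡ k * (a - b) + k * (b - r)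
      split = solve-∀

    lifted : F (h ℕ.+ y ℕ.+ x) ≡ r [mod pw (suc t) ]
    lifted = subst (λ n → F n ≡ r [mod pw (suc t) ]) (sym (ℕ.+-assoc h y x))
               (congruent (K-cancelℤ (suc t) (≡0-mod⇒∣ KΔ≡0)))

  hensel-lift : ∀ {x a r} → a * D x ≡ + 1 [mod + p ] → F x ≡ r [mod + p ] →
                ∀ s → ∃ λ y → p ^ (L ℕ.+ 1) ℕ∣.∣ y × F (y ℕ.+ x) ≡ r [mod pw (suc s) ]
  hensel-lift aD≡1 Fx≡r zero    =
    0 , ℕ∣._∣0 _ , mod-weaken (∣-reflexive (cong +_ (ℕ.*-identityʳ p))) Fx≡r
  hensel-lift {a = a} aD≡1 Fx≡r (suc s) with hensel-lift {a = a} aD≡1 Fx≡r s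
  ... | y , pᴸ⁺¹∣y , Fy+x≡r = hensel-step {a = a} aD≡1 s pᴸ⁺¹∣y Fy+x≡r

  universal-at : (∀ r → r < p → ∃ λ x → F x ≡ + r [mod + p ] × ¬ (+ p ∣ D x)) →
                 ∀ b → (p ^ b) IsUniversalFor (suc k′)
  universal-at roots zero    zero    _    = 0 , 0 , refl
  universal-at roots zero    (suc r) (s≤s ())
  universal-at roots (suc s) r       r<pᵇ with roots (r ℕ.% p) (m%n<n r p)
  ... | x , Fx≡r%p , p∤Dx with inverse-mod p-prime p∤Dx
  ...   | a , aDx≡1 with hensel-lift {a = a} aDx≡1 (mod-trans Fx≡r%p (mod-sym (residue-≡ (+ r) p))) s
  ...     | y , _ , Fy+x≡r = y ℕ.+ x , representative {{ℕ.m^n≢0 p (suc s)}} Fy+x≡r r<pᵇ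

lcm-upto : ℕ → ℕ
lcm-upto zero    = 1
lcm-upto (suc k) = lcm (suc k) (lcm-upto k)

lcm-upto-multiple : ∀ k i → i < k → suc i ℕ∣.∣ lcm-upto k
lcm-upto-multiple (suc k) i (s≤s i≤k) with ℕ.m≤n⇒m<n∨m≡n i≤k
... | inj₁ i<k  = ℕ∣.∣-trans (lcm-upto-multiple k i i<k) (n∣lcm[m,n] (suc k) (lcm-upto k))
... | inj₂ refl = m∣lcm[m,n] (suc i) (lcm-upto i)

lcm-upto-nonZero : ∀ k → NonZero (lcm-upto k)
lcm-upto-nonZero zero    = _
lcm-upto-nonZero (suc k) = ℕ.≢-nonZero λ lcm≡0 →
  ℕ.≢-nonZero⁻¹ (suc k ℕ.* lcm-upto k) {{ℕ.m*n≢0 (suc k) (lcm-upto k) {{_}} {{lcm-upto-nonZero k}}}}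
    (ℕ∣.0∣⇒≡0 (subst (ℕ∣._∣ suc k ℕ.* lcm-upto k) lcm≡0
      (lcm-least (ℕ∣.m∣m*n (lcm-upto k)) (ℕ∣.n∣m*n (suc k)))))

NonsingularRoot : (k′ p r x : ℕ) → Set
NonsingularRoot k′ p r x =
  binom x (suc k′) ≡ + r [mod + p ] × ¬ (+ p ∣ scaled-derivative k′ (lcm-upto (suc k′)) x)

nonsingularRoot? : ∀ k′ p r x → Dec (NonsingularRoot k′ p r x)
nonsingularRoot? k′ p r x = map′ congruent divides-difference (+ p ∣? _) ×-dec ¬? (+ p ∣? _)

-- A root table lists, for some primes p, one candidate root for each residue
-- r = 0, 1, …, p−1 (in this order); row selects the list for p, listed-root the entry for r.
row : List (ℕ × List ℕ) → ℕ → List ℕ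
row []                p = []
row ((q , xs) ∷ rows) p = if q ℕ.≡ᵇ p then xs else row rows p

listed-root : List (ℕ × List ℕ) → ℕ → ℕ → ℕ
listed-root table p r = fromMaybe 0 (head (drop r (row table p)))

Certifies : ℕ → List (ℕ × List ℕ) → Set
Certifies k′ table = ∀ {p} → p < suc (suc k′) → Prime p →
                     ∀ {r} → r < p → NonsingularRoot k′ p r (listed-root table p r)

certifies? : ∀ k′ table → Dec (Certifies k′ table)
certifies? k′ table =
  ℕ.allUpTo? (λ p → prime? p →-dec ℕ.allUpTo? (λ r → nonsingularRoot? k′ p r _) p) (suc (suc k′))

certified-universal : ∀ k′ table → Certifies k′ table → Universal (suc k′)
certified-universal k′ table certificate p p-prime p≤k
  with p-part p-prime (lcm-upto (suc k′)) {{lcm-upto-nonZero (suc k′)}}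
... | L , K′ , K≡ , p∤K′ = Hensel.universal-at k′ p (lcm-upto (suc k′)) L K′ p-prime
  (λ i i≤k′ → lcm-upto-multiple (suc k′) i (s≤s i≤k′)) K≡ p∤K′
  (λ r r<p → listed-root table p r , certificate (s≤s p≤k) p-prime r<p)

-- Nonsingular roots for k = 11, 17, 29 (for each residue the least such x ≥ 0).
table-11 : List (ℕ × List ℕ)
table-11 =
  (2 , 3 ∷ 11 ∷ []) ∷
  (3 , 2 ∷ 11 ∷ 20 ∷ []) ∷
  (5 , 1 ∷ 11 ∷ 12 ∷ 13 ∷ 14 ∷ []) ∷
  (7 , 4 ∷ 11 ∷ 18 ∷ 19 ∷ 32 ∷ 12 ∷ 33 ∷ []) ∷
  (11 , 0 ∷ 11 ∷ 22 ∷ 33 ∷ 44 ∷ 55 ∷ 66 ∷ 77 ∷ 88 ∷ 99 ∷ 110 ∷ []) ∷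
  []

table-17 : List (ℕ × List ℕ)
table-17 =
  (2 , 1 ∷ 17 ∷ []) ∷
  (3 , 8 ∷ 17 ∷ 26 ∷ []) ∷
  (5 , 2 ∷ 17 ∷ 23 ∷ 18 ∷ 22 ∷ []) ∷
  (7 , 3 ∷ 17 ∷ 26 ∷ 19 ∷ 18 ∷ 25 ∷ 20 ∷ []) ∷
  (11 , 6 ∷ 17 ∷ 28 ∷ 29 ∷ 50 ∷ 61 ∷ 19 ∷ 18 ∷ 63 ∷ 73 ∷ 40 ∷ []) ∷
  (13 , 4 ∷ 17 ∷ 19 ∷ 43 ∷ 32 ∷ 18 ∷ 45 ∷ 57 ∷ 58 ∷ 20 ∷ 31 ∷ 98 ∷ 70 ∷ []) ∷
  (17 , 0 ∷ 17 ∷ 34 ∷ 51 ∷ 68 ∷ 85 ∷ 102 ∷ 119 ∷ 136 ∷ 153 ∷ 170 ∷ 187 ∷ 204 ∷ 221 ∷ 238 ∷ 255 ∷ 272 ∷ []) ∷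
  []

table-29 : List (ℕ × List ℕ)
table-29 =
  (2 , 13 ∷ 29 ∷ []) ∷
  (3 , 2 ∷ 29 ∷ 56 ∷ []) ∷
  (5 , 4 ∷ 29 ∷ 54 ∷ 79 ∷ 104 ∷ []) ∷
  (7 , 1 ∷ 29 ∷ 30 ∷ 31 ∷ 32 ∷ 33 ∷ 34 ∷ []) ∷
  (11 , 7 ∷ 29 ∷ 41 ∷ 31 ∷ 52 ∷ 54 ∷ 51 ∷ 53 ∷ 30 ∷ 42 ∷ 32 ∷ []) ∷
  (13 , 3 ∷ 29 ∷ 59 ∷ 36 ∷ 30 ∷ 48 ∷ 35 ∷ 32 ∷ 45 ∷ 33 ∷ 31 ∷ 56 ∷ 38 ∷ []) ∷
  (17 , 12 ∷ 29 ∷ 46 ∷ 63 ∷ 80 ∷ 64 ∷ 31 ∷ 82 ∷ 133 ∷ 47 ∷ 115 ∷ 183 ∷ 48 ∷ 30 ∷ 98 ∷ 166 ∷ 234 ∷ []) ∷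
  (19 , 10 ∷ 29 ∷ 48 ∷ 49 ∷ 86 ∷ 105 ∷ 87 ∷ 52 ∷ 69 ∷ 31 ∷ 200 ∷ 30 ∷ 163 ∷ 33 ∷ 68 ∷ 147 ∷ 126 ∷ 88 ∷ 50 ∷ []) ∷
  (23 , 6 ∷ 29 ∷ 34 ∷ 33 ∷ 35 ∷ 31 ∷ 56 ∷ 30 ∷ 58 ∷ 79 ∷ 54 ∷ 220 ∷ 81 ∷ 37 ∷ 36 ∷ 32 ∷ 83 ∷ 192 ∷ 148 ∷ 82 ∷ 100 ∷ 76 ∷ 78 ∷ []) ∷
  (29 , 0 ∷ 29 ∷ 58 ∷ 87 ∷ 116 ∷ 145 ∷ 174 ∷ 203 ∷ 232 ∷ 261 ∷ 290 ∷ 319 ∷ 348 ∷ 377 ∷ 406 ∷ 435 ∷ 464 ∷ 493 ∷ 522 ∷ 551 ∷ 580 ∷ 609 ∷ 638 ∷ 667 ∷ 696 ∷ 725 ∷ 754 ∷ 783 ∷ 812 ∷ []) ∷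
  []

theorem1p3 : Universal 11 × Universal 17 × Universal 29
theorem1p3 =
  certified-universal 10 table-11 (from-yes (certifies? 10 table-11)) ,
  certified-universal 16 table-17 (from-yes (certifies? 16 table-17)) ,
  certified-universal 28 table-29 (from-yes (certifies? 28 table-29))
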